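{- Let $n\geq 2$ and let $j$ be an integer with $2\leq j\leq n$. Then there exist two subgraphs of the augmented cube $AQ_n$, each isomorphic to the hypercube $Q_n$, whose edge sets intersect exactly in $E_j$; and there exist two subgraphs of $AQ_n$, each isomorphic to $Q_n$, whose edge sets intersect exactly in $E_{\leq j}$.
   Context: The hypercube $Q_n$ has vertex set $\{0,1\}^n$, two vertices adjacent iff they differ in exactly one bit. The augmented cube $AQ_n$ has vertex set $\{0,1\}^n$ (strings $x_n\cdots x_1$) and edge set $\left(\bigcup_{i=1}^n E_i\right)\cup\left(\bigcup_{j=2}^n E_{\leq j}\right)$, where $E_i=\{(x_n\cdots x_1,\ x_n\cdots x_{i+1}(x_i+1)x_{i-1}\cdots x_1)\}$ (hypercube edges of dimension $i$: flip bit $i$) and $E_{\leq j}=\{(x_n\cdots x_1,\ x_n\cdots x_{j+1}(x_j+1)\cdots(x_1+1))\}$ (augmented edges of dimension $j$: flip bits $1,\dots,j$), addition mod 2. -}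

module Defs where

open import Data.Nat using (ℕ; zero; suc; _≤_)
open import Data.Bool using (Bool; not)
open import Data.Fin using (Fin; zero; suc; toℕ)
open import Data.Vec using (Vec; []; _∷_)
open import Data.Product using (Σ; _×_; ∃)
open import Data.Sum using (_⊎_)
open import Function.Definitions using (Bijective)
open import Function.Bundles using (_⇔_)
open import Relation.Binary.PropositionalEquality using (_≡_)

-- Vertex x_n ⋯ x_1 is stored as the vector x_1 ∷ x_2 ∷ ⋯ ∷ x_n ∷ []
-- (position k : Fin n holds bit number toℕ k + 1).
V : ℕ → Set
V n = Vec Bool n

flipBit : ∀ {n} → Fin n → V n → V n
flipBit zero    (x ∷ xs) = not x ∷ xs
flipBit (suc k) (x ∷ xs) = x ∷ flipBit k xs

flipLow : ∀ {n} → ℕ → V n → V n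
flipLow zero    xs       = xs
flipLow (suc j) []       = []
flipLow (suc j) (x ∷ xs) = not x ∷ flipLow j xs

EdgeSet : ℕ → Set₁
EdgeSet n = V n → V n → Set

E : ∀ {n} → ℕ → EdgeSet n
E {n} i u v = Σ (Fin n) λ k → (suc (toℕ k) ≡ i) × (v ≡ flipBit k u)

E≤ : ∀ {n} → ℕ → EdgeSet n
E≤ j u v = v ≡ flipLow j u

Qadj : ∀ {n} → EdgeSet n
Qadj {n} u v = Σ ℕ λ i → (1 ≤ i) × (i ≤ n) × E i u v

AQadj : ∀ {n} → EdgeSet n
AQadj {n} u v =
  (Σ ℕ λ i → (1 ≤ i) × (i ≤ n) × E i u v)
  ⊎ (Σ ℕ λ j → (2 ≤ j) × (j ≤ n) × E≤ j u v)

-- H (a spanning subgraph of AQ_n given by its edge set) is a subgraph of AQ_n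
-- isomorphic to Q_n: its edges are edges of AQ_n, and some bijection φ of the
-- vertex set maps Q_n-adjacency exactly onto H-adjacency.
-- (A subgraph isomorphic to Q_n has 2^n vertices, hence is spanning.)
IsQnSubgraph : ∀ n → EdgeSet n → Set
IsQnSubgraph n H =
  (∀ u v → H u v → AQadj u v)
  × Σ (V n → V n) λ φ → Bijective _≡_ _≡_ φ
      × (∀ u v → Qadj u v ⇔ H (φ u) (φ v))

IntersectExactly : ∀ {n} → EdgeSet n → EdgeSet n → EdgeSet n → Set
IntersectExactly H₁ H₂ F = ∀ u v → (H₁ u v × H₂ u v) ⇔ F u v

{-# OPTIONS --safe #-}
-- AQ_n is the Cayley graph of Z₂ⁿ with respect to the generators e₁, …, eₙ (eⱼ flips bit j) and
-- f₂, …, fₙ (fⱼ flips bits 1, …, j). If n generators form a basis, the linear map sending eₖ to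
-- the k-th of them is an isomorphism from Q_n onto the Cayley subgraph they span. Distinct
-- generators move a vertex to distinct neighbours, so two such Cayley subgraphs share exactly
-- the edges of their common generators. It remains to choose bases: {e₁, …, eₙ} and
-- {e₂, f₂, …, fₙ} meet in e₂; Wⱼ = {eᵢ : i ≠ 2} ∪ {fⱼ} and {e₂, f₂, …, fₙ} meet in fⱼ; and for
-- j ≥ 3, Wⱼ and {e₂, eⱼ} ∪ {fᵢ : i ≠ j} meet in eⱼ.
module Submission where

open import Defs
open import Data.Nat using (ℕ; zero; suc; _+_; _≤_; z≤n; s≤s)
import Data.Nat.Properties as ℕ
open import Data.Bool using (Bool; true; false; not; _xor_)
open import Data.Bool.Properties
  using (not-involutive; not-¬; not-distribˡ-xor; not-distribʳ-xor; xor-assoc; xor-same;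
         xor-identityʳ)
open import Data.Fin using (Fin; zero; suc; toℕ; inject₁; fromℕ<)
open import Data.Fin.Properties
  using (toℕ<n; toℕ-injective; toℕ-inject₁; toℕ-fromℕ<; suc-injective; _≟_)
open import Data.Vec using ([]; _∷_; head; tail)
open import Data.Product using (Σ; ∃; _×_; _,_)
open import Data.Sum using (inj₁; inj₂)
open import Data.Empty using (⊥-elim)
open import Function using (_∘_; _↔_; _⇔_; mk⇔; Inverse)
open import Function.Bundles using (mk↔ₛ′; Bijection)
open import Function.Construct.Composition using (_↔-∘_; _⇔-∘_)
open import Function.Construct.Identity using (↔-id)
open import Function.Properties.Inverse using (↔⇒⤖)
open import Relation.Nullary using (yes; no)
open import Relation.Binary.PropositionalEquality

xor-cancelʳ : ∀ a b → (a xor b) xor b ≡ a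
xor-cancelʳ a b = trans (xor-assoc a b b) (trans (cong (a xor_) (xor-same b)) (xor-identityʳ a))

flipLow-involutive : ∀ {n} j (x : V n) → flipLow j (flipLow j x) ≡ x
flipLow-involutive zero    x        = refl
flipLow-involutive (suc j) []       = refl
flipLow-involutive (suc j) (a ∷ xs) = cong₂ _∷_ (not-involutive a) (flipLow-involutive j xs)

flipLow-flipBit-comm : ∀ {n} j (k : Fin n) x → flipLow j (flipBit k x) ≡ flipBit k (flipLow j x)
flipLow-flipBit-comm zero    k       x        = refl
flipLow-flipBit-comm (suc j) zero    (a ∷ xs) = refl
flipLow-flipBit-comm (suc j) (suc k) (a ∷ xs) = cong (not a ∷_) (flipLow-flipBit-comm j k xs)

flipLow-flipLow-suc : ∀ {n} (k : Fin n) x → flipLow (toℕ k) (flipLow (suc (toℕ k)) x) ≡ flipBit k x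
flipLow-flipLow-suc zero    (a ∷ xs) = refl
flipLow-flipLow-suc (suc k) (a ∷ xs) = cong₂ _∷_ (not-involutive a) (flipLow-flipLow-suc k xs)

flipBit-injectiveˡ : ∀ {n} (k l : Fin n) x → flipBit k x ≡ flipBit l x → k ≡ l
flipBit-injectiveˡ zero    zero    x        eq = refl
flipBit-injectiveˡ zero    (suc l) (a ∷ xs) eq = ⊥-elim (not-¬ refl (sym (cong head eq)))
flipBit-injectiveˡ (suc k) zero    (a ∷ xs) eq = ⊥-elim (not-¬ refl (cong head eq))
flipBit-injectiveˡ (suc k) (suc l) (a ∷ xs) eq = cong suc (flipBit-injectiveˡ k l xs (cong tail eq))

flipLow-injectiveˡ : ∀ {n} (k l : Fin n) (x : V n) →
  flipLow (suc (toℕ k)) x ≡ flipLow (suc (toℕ l)) x → k ≡ l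
flipLow-injectiveˡ zero    zero    x            eq = refl
flipLow-injectiveˡ zero    (suc l) (a ∷ b ∷ xs) eq = ⊥-elim (not-¬ refl (cong (head ∘ tail) eq))
flipLow-injectiveˡ (suc k) zero    (a ∷ b ∷ xs) eq =
  ⊥-elim (not-¬ refl (sym (cong (head ∘ tail) eq)))
flipLow-injectiveˡ (suc k) (suc l) (a ∷ xs)     eq =
  cong suc (flipLow-injectiveˡ k l xs (cong tail eq))

flipBit≢flipLow : ∀ {n} (k : Fin (suc n)) (l : Fin n) x → flipBit k x ≢ flipLow (2 + toℕ l) x
flipBit≢flipLow zero    l (a ∷ b ∷ xs) eq = not-¬ refl (cong (head ∘ tail) eq)
flipBit≢flipLow (suc k) l (a ∷ b ∷ xs) eq = not-¬ refl (cong head eq)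

-- aug k is the augmented generator of dimension k + 2; dimension 1 would duplicate hyp zero.
data Generator : ℕ → Set where
  hyp : ∀ {n} → Fin n → Generator n
  aug : ∀ {n} → Fin n → Generator (suc n)

apply : ∀ {n} → Generator n → V n → V n
apply (hyp k) = flipBit k
apply (aug k) = flipLow (2 + toℕ k)

apply-injectiveˡ : ∀ {n} (g h : Generator n) x → apply g x ≡ apply h x → g ≡ h
apply-injectiveˡ (hyp k) (hyp l) x eq = cong hyp (flipBit-injectiveˡ k l x eq)
apply-injectiveˡ (hyp k) (aug l) x eq = ⊥-elim (flipBit≢flipLow k l x eq)
apply-injectiveˡ (aug k) (hyp l) x eq = ⊥-elim (flipBit≢flipLow l k x (sym eq))
apply-injectiveˡ (aug k) (aug l) x eq =
  cong aug (suc-injective (flipLow-injectiveˡ (suc k) (suc l) x eq))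

apply-AQadj : ∀ {n} (g : Generator n) x → AQadj x (apply g x)
apply-AQadj (hyp k) x = inj₁ (suc (toℕ k) , s≤s z≤n , toℕ<n k , k , refl , refl)
apply-AQadj (aug k) x = inj₂ (2 + toℕ k , s≤s (s≤s z≤n) , s≤s (toℕ<n k) , refl)

Cayley : ∀ {n} → (Fin n → Generator n) → EdgeSet n
Cayley σ x y = ∃ λ k → y ≡ apply (σ k) x

Qadj⇔Cayley-hyp : ∀ {n} (x y : V n) → Qadj x y ⇔ Cayley hyp x y
Qadj⇔Cayley-hyp x y = mk⇔ (λ (_ , _ , _ , k , _ , e) → k , e)
                           (λ (k , e) → suc (toℕ k) , s≤s z≤n , toℕ<n k , k , refl , e)

flipBit⇔E : ∀ {n} (k : Fin n) (x y : V n) → (y ≡ flipBit k x) ⇔ E (suc (toℕ k)) x y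
flipBit⇔E k x y = mk⇔ (λ e → k , refl , e)
  (λ (l , l≡k , e) → subst (λ i → y ≡ flipBit i x) (toℕ-injective (ℕ.suc-injective l≡k)) e)

Intertwines : ∀ {n} → (V n → V n) → (Fin n → Generator n) → Set
Intertwines φ σ = ∀ k x → φ (flipBit k x) ≡ apply (σ k) (φ x)

record QnIso {n} (σ : Fin n → Generator n) : Set where
  constructor _,_
  field
    iso         : V n ↔ V n
    intertwines : Intertwines (Inverse.to iso) σ

cayley-isQnSubgraph : ∀ {n} {σ : Fin n → Generator n} → QnIso σ → IsQnSubgraph n (Cayley σ)
cayley-isQnSubgraph {σ = σ} (φ , comm) =
  (λ x y (k , e) → subst (AQadj x) (sym e) (apply-AQadj (σ k) x)) ,
  to , bijective , λ x y → mk⇔ (toCayley x y) (fromCayley x y) ⇔-∘ Qadj⇔Cayley-hyp x y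
  where
    open Bijection (↔⇒⤖ φ) using (to; injective; bijective)
    toCayley : ∀ x y → Cayley hyp x y → Cayley σ (to x) (to y)
    toCayley x y (k , e) = k , trans (cong to e) (comm k x)
    fromCayley : ∀ x y → Cayley σ (to x) (to y) → Cayley hyp x y
    fromCayley x y (k , e) = k , injective (trans e (sym (comm k x)))

QnPairMeetingIn : ∀ n → EdgeSet n → Set₁
QnPairMeetingIn n F = Σ (EdgeSet n) λ H₁ → Σ (EdgeSet n) λ H₂ →
  IsQnSubgraph n H₁ × IsQnSubgraph n H₂ × IntersectExactly H₁ H₂ F

QnPairMeetingIn-resp-⇔ : ∀ {n} {F G : EdgeSet n} → (∀ x y → F x y ⇔ G x y) →
  QnPairMeetingIn n F → QnPairMeetingIn n G
QnPairMeetingIn-resp-⇔ F⇔G (H₁ , H₂ , iso₁ , iso₂ , meet) =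
  H₁ , H₂ , iso₁ , iso₂ , λ x y → F⇔G x y ⇔-∘ meet x y

cayley-meetingIn : ∀ {n} {σ τ : Fin n → Generator n} (g : Generator n) →
  QnIso σ → QnIso τ → (∃ λ k → σ k ≡ g) → (∃ λ l → τ l ≡ g) →
  (∀ k l → σ k ≡ τ l → σ k ≡ g) →
  QnPairMeetingIn n (λ x y → y ≡ apply g x)
cayley-meetingIn {σ = σ} {τ} g isoσ isoτ (k₀ , σk₀≡g) (l₀ , τl₀≡g) common =
  Cayley σ , Cayley τ , cayley-isQnSubgraph isoσ , cayley-isQnSubgraph isoτ ,
  λ x y → mk⇔ (shared x y) (λ e → (k₀ , along σk₀≡g e) , (l₀ , along τl₀≡g e))
  where
    along : ∀ {h x y} → h ≡ g → y ≡ apply g x → y ≡ apply h x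
    along refl e = e
    shared : ∀ x y → Cayley σ x y × Cayley τ x y → y ≡ apply g x
    shared x y ((k , e) , (l , e′)) =
      trans e (cong (λ h → apply h x) (common k l σk≡τl))
      where
        σk≡τl : σ k ≡ τ l
        σk≡τl = apply-injectiveˡ (σ k) (τ l) x (trans (sym e) e′)

standard : ∀ {n} → Fin n → Generator n
standard = hyp

standard-iso : ∀ {n} → QnIso (standard {n})
standard-iso = ↔-id _ , λ k x → refl

head₀ : ∀ {n} → V n → Bool
head₀ []      = false
head₀ (x ∷ _) = x

-- Bit i of runningXor x is xᵢ ⊕ xᵢ₊₁ ⊕ ⋯ ⊕ xₙ, so runningXor sends eᵢ to fᵢ.
runningXor : ∀ {n} → V n → V n
runningXor []       = []
runningXor (x ∷ xs) = (x xor head₀ (runningXor xs)) ∷ runningXor xs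

adjacentXor : ∀ {n} → V n → V n
adjacentXor []       = []
adjacentXor (y ∷ ys) = (y xor head₀ ys) ∷ adjacentXor ys

runningXor-↔ : ∀ {n} → V n ↔ V n
runningXor-↔ = mk↔ₛ′ runningXor adjacentXor runningXor-adjacentXor adjacentXor-runningXor
  where
    runningXor-adjacentXor : ∀ {n} (y : V n) → runningXor (adjacentXor y) ≡ y
    runningXor-adjacentXor []       = refl
    runningXor-adjacentXor (y ∷ ys) rewrite runningXor-adjacentXor ys =
      cong (_∷ ys) (xor-cancelʳ y (head₀ ys))
    adjacentXor-runningXor : ∀ {n} (x : V n) → adjacentXor (runningXor x) ≡ x
    adjacentXor-runningXor []       = refl
    adjacentXor-runningXor (x ∷ xs) =
      cong₂ _∷_ (xor-cancelʳ x (head₀ (runningXor xs))) (adjacentXor-runningXor xs)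

runningXor-flipBit : ∀ {n} (k : Fin n) x →
  runningXor (flipBit k x) ≡ flipLow (suc (toℕ k)) (runningXor x)
runningXor-flipBit zero    (x ∷ xs)     = cong (_∷ runningXor xs) (sym (not-distribˡ-xor x _))
runningXor-flipBit (suc k) (x ∷ y ∷ ys) rewrite runningXor-flipBit k (y ∷ ys) =
  cong (_∷ _) (sym (not-distribʳ-xor x _))

swap₁₂ : ∀ {n} → V (2 + n) → V (2 + n)
swap₁₂ (a ∷ b ∷ xs) = b ∷ a ∷ xs

swap₁₂-↔ : ∀ {n} → V (2 + n) ↔ V (2 + n)
swap₁₂-↔ = mk↔ₛ′ swap₁₂ swap₁₂ swap₁₂-involutive swap₁₂-involutive
  where
    swap₁₂-involutive : ∀ x → swap₁₂ (swap₁₂ x) ≡ x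
    swap₁₂-involutive (a ∷ b ∷ xs) = refl

augmented : ∀ {n} → Fin (2 + n) → Generator (2 + n)
augmented zero    = hyp (suc zero)
augmented (suc k) = aug k

augmented-iso : ∀ {n} → QnIso (augmented {n})
augmented-iso = swap₁₂-↔ ↔-∘ runningXor-↔ , intertwines
  where
    intertwines : Intertwines (swap₁₂ ∘ runningXor) augmented
    intertwines zero    x rewrite runningXor-flipBit zero x with runningXor x
    ... | a ∷ b ∷ xs = refl
    intertwines (suc k) x rewrite runningXor-flipBit (suc k) x with runningXor x
    ... | a ∷ b ∷ xs = refl

standard-e₂↦f : ∀ {n} → Fin (suc n) → Fin (2 + n) → Generator (2 + n)
standard-e₂↦f J zero          = hyp zero
standard-e₂↦f J (suc zero)    = aug J
standard-e₂↦f J (suc (suc k)) = hyp (suc (suc k))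

-- The transvection x ↦ x + x₂ (e₂ + f_{J+2}): it sends e₂ to f_{J+2} and fixes every other eᵢ.
shear : ∀ {n} → Fin (suc n) → V (2 + n) → V (2 + n)
shear J (a ∷ false ∷ xs) = a ∷ false ∷ xs
shear J (a ∷ true  ∷ xs) = not a ∷ true ∷ flipLow (toℕ J) xs

standard-e₂↦f-iso : ∀ {n} (J : Fin (suc n)) → QnIso (standard-e₂↦f J)
standard-e₂↦f-iso J =
  mk↔ₛ′ (shear J) (shear J) shear-involutive shear-involutive , intertwines
  where
    shear-involutive : ∀ x → shear J (shear J x) ≡ x
    shear-involutive (a ∷ false ∷ xs) = refl
    shear-involutive (a ∷ true  ∷ xs) =
      cong₂ (λ b ys → b ∷ true ∷ ys) (not-involutive a) (flipLow-involutive (toℕ J) xs)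
    intertwines : Intertwines (shear J) (standard-e₂↦f J)
    intertwines zero          (a ∷ false ∷ xs) = refl
    intertwines zero          (a ∷ true  ∷ xs) = refl
    intertwines (suc zero)    (a ∷ false ∷ xs) = refl
    intertwines (suc zero)    (a ∷ true  ∷ xs) =
      sym (cong₂ (λ b ys → b ∷ false ∷ ys) (not-involutive a) (flipLow-involutive (toℕ J) xs))
    intertwines (suc (suc k)) (a ∷ false ∷ xs) = refl
    intertwines (suc (suc k)) (a ∷ true  ∷ xs) =
      cong (λ ys → not a ∷ true ∷ ys) (flipLow-flipBit-comm (toℕ J) k xs)

addNext : ∀ {n} → Fin n → V (suc n) → V (suc n)
addNext zero    (a ∷ b ∷ xs) = (a xor b) ∷ b ∷ xs
addNext (suc i) (a ∷ xs)     = a ∷ addNext i xs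

addNext-involutive : ∀ {n} (i : Fin n) x → addNext i (addNext i x) ≡ x
addNext-involutive zero    (a ∷ b ∷ xs) = cong (_∷ b ∷ xs) (xor-cancelʳ a b)
addNext-involutive (suc i) (a ∷ xs)     = cong (a ∷_) (addNext-involutive i xs)

addNext-flipBit-suc : ∀ {n} (i : Fin n) x →
  addNext i (flipBit (suc i) x) ≡ flipBit (inject₁ i) (flipBit (suc i) (addNext i x))
addNext-flipBit-suc zero    (a ∷ b ∷ xs) = cong (_∷ not b ∷ xs) (sym (not-distribʳ-xor a b))
addNext-flipBit-suc (suc i) (a ∷ xs)     = cong (a ∷_) (addNext-flipBit-suc i xs)

addNext-flipBit : ∀ {n} (i : Fin n) (k : Fin (suc n)) x → k ≢ suc i →
  addNext i (flipBit k x) ≡ flipBit k (addNext i x)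
addNext-flipBit zero    zero          (a ∷ b ∷ xs) _   =
  cong (_∷ b ∷ xs) (sym (not-distribˡ-xor a b))
addNext-flipBit zero    (suc zero)    x            k≢1 = ⊥-elim (k≢1 refl)
addNext-flipBit zero    (suc (suc k)) (a ∷ b ∷ xs) _   = refl
addNext-flipBit (suc i) zero          (a ∷ xs)     _   = refl
addNext-flipBit (suc i) (suc k)       (a ∷ xs)     k≢i =
  cong (a ∷_) (addNext-flipBit i k xs (k≢i ∘ cong suc))

augmented-f↦e : ∀ {n} → Fin n → Fin (2 + n) → Generator (2 + n)
augmented-f↦e i k with k ≟ suc (suc i)
... | yes _ = hyp k
... | no  _ = augmented k

-- addNext (suc i) turns e_{i+3} into e_{i+3} + e_{i+2}, which the map of augmented-iso sends to
-- f_{i+3} + f_{i+2} = e_{i+3}.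
augmented-f↦e-iso : ∀ {n} (i : Fin n) → QnIso (augmented-f↦e i)
augmented-f↦e-iso {n} i = iso ↔-∘ addNext-↔ , intertwines
  where
    open QnIso augmented-iso renaming (intertwines to augmented-intertwines)
    φ : V (2 + n) → V (2 + n)
    φ = Inverse.to iso
    addNext-↔ : V (2 + n) ↔ V (2 + n)
    addNext-↔ = mk↔ₛ′ (addNext (suc i)) (addNext (suc i))
                      (addNext-involutive (suc i)) (addNext-involutive (suc i))
    intertwines : Intertwines (φ ∘ addNext (suc i)) (augmented-f↦e i)
    intertwines k x with k ≟ suc (suc i)
    ... | no  k≢ =
      trans (cong φ (addNext-flipBit (suc i) k x k≢)) (augmented-intertwines k (addNext (suc i) x))
    ... | yes refl = begin
      φ (addNext (suc i) (flipBit (suc (suc i)) x))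
        ≡⟨ cong φ (addNext-flipBit-suc (suc i) x) ⟩
      φ (flipBit (suc (inject₁ i)) (flipBit (suc (suc i)) w))
        ≡⟨ augmented-intertwines (suc (inject₁ i)) _ ⟩
      flipLow (2 + toℕ (inject₁ i)) (φ (flipBit (suc (suc i)) w))
        ≡⟨ cong₂ (λ t → flipLow (2 + t)) (toℕ-inject₁ i) (augmented-intertwines (suc (suc i)) w) ⟩
      flipLow (2 + toℕ i) (flipLow (3 + toℕ i) (φ w))
        ≡⟨ flipLow-flipLow-suc (suc (suc i)) (φ w) ⟩
      flipBit (suc (suc i)) (φ w) ∎
      where
        open ≡-Reasoning
        w : V (2 + n)
        w = addNext (suc i) x

augmented-aug : ∀ {n} (l : Fin (2 + n)) {J} → augmented l ≡ aug J → l ≡ suc J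
augmented-aug zero    ()
augmented-aug (suc l) refl = refl

standard∩augmented : ∀ {n} (k l : Fin (2 + n)) →
  standard k ≡ augmented l → standard k ≡ hyp (suc zero)
standard∩augmented k zero    eq = eq
standard∩augmented k (suc l) ()

standard-e₂↦f∩augmented : ∀ {n} (J : Fin (suc n)) k l →
  standard-e₂↦f J k ≡ augmented l → standard-e₂↦f J k ≡ aug J
standard-e₂↦f∩augmented J zero          zero    ()
standard-e₂↦f∩augmented J zero          (suc l) ()
standard-e₂↦f∩augmented J (suc zero)    l       _ = refl
standard-e₂↦f∩augmented J (suc (suc k)) zero    ()
standard-e₂↦f∩augmented J (suc (suc k)) (suc l) ()

augmented-f↦e-at : ∀ {n} (i : Fin n) → augmented-f↦e i (suc (suc i)) ≡ hyp (suc (suc i))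
augmented-f↦e-at i with suc (suc i) ≟ suc (suc i)
... | yes _ = refl
... | no  ≢ = ⊥-elim (≢ refl)

standard-e₂↦f∩augmented-f↦e : ∀ {n} (i : Fin n) k l →
  standard-e₂↦f (suc i) k ≡ augmented-f↦e i l → standard-e₂↦f (suc i) k ≡ hyp (suc (suc i))
standard-e₂↦f∩augmented-f↦e i k l eq with l ≟ suc (suc i)
... | yes refl = eq
... | no  l≢   =
  ⊥-elim (l≢ (augmented-aug l (trans (sym eq) (standard-e₂↦f∩augmented (suc i) k l eq))))

meetingIn-E : ∀ {n} (J : Fin (suc n)) → QnPairMeetingIn (2 + n) (E (2 + toℕ J))
meetingIn-E zero = QnPairMeetingIn-resp-⇔ (flipBit⇔E (suc zero))
  (cayley-meetingIn (hyp (suc zero)) standard-iso augmented-iso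
    (suc zero , refl) (zero , refl) standard∩augmented)
meetingIn-E (suc i) = QnPairMeetingIn-resp-⇔ (flipBit⇔E (suc (suc i)))
  (cayley-meetingIn (hyp (suc (suc i))) (standard-e₂↦f-iso (suc i)) (augmented-f↦e-iso i)
    (suc (suc i) , refl) (suc (suc i) , augmented-f↦e-at i) (standard-e₂↦f∩augmented-f↦e i))

meetingIn-E≤ : ∀ {n} (J : Fin (suc n)) → QnPairMeetingIn (2 + n) (E≤ (2 + toℕ J))
meetingIn-E≤ J = cayley-meetingIn (aug J) (standard-e₂↦f-iso J) augmented-iso
  (suc zero , refl) (suc J , refl) (standard-e₂↦f∩augmented J)

theorem3p4 : ∀ (n : ℕ) → 2 ≤ n → ∀ (j : ℕ) → 2 ≤ j → j ≤ n →
    (Σ (EdgeSet n) λ H₁ → Σ (EdgeSet n) λ H₂ →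
        IsQnSubgraph n H₁ × IsQnSubgraph n H₂ × IntersectExactly H₁ H₂ (E j))
    × (Σ (EdgeSet n) λ H₁ → Σ (EdgeSet n) λ H₂ →
        IsQnSubgraph n H₁ × IsQnSubgraph n H₂ × IntersectExactly H₁ H₂ (E≤ j))
theorem3p4 (suc (suc n)) _ (suc (suc j)) (s≤s (s≤s z≤n)) (s≤s (s≤s j≤n))
  with fromℕ< (s≤s j≤n) | toℕ-fromℕ< (s≤s j≤n)
... | J | refl = meetingIn-E J , meetingIn-E≤ J
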